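{- Let $n,m$ be positive integers with $1\le n\le 2^{m-1}-1$. Then $$g(n,m) > \frac{n(m+1)}{\log_2(n+1)+2}.$$ In particular $g(n,m)=\Omega\!\left(\frac{nm}{\log_2 n}\right)$.
   Context: Write $[m]=\{1,\ldots,m\}$. For a multiset $\mathcal{F}=\{C_1,\ldots,C_k\}$ of non-empty subsets of $[m]$ (repetitions allowed; members indexed by $[k]$), a resolution into $n$ classes is a partition $\{A_1,\ldots,A_n\}$ of $[k]$ into $n$ blocks such that for each $i$ the sets $C_j$, $j\in A_i$, are pairwise disjoint with union $[m]$. $\mathcal{F}$ is uniquely resolvable with respect to $(n,m)$ if it has exactly one resolution into $n$ classes (partitions regarded as unordered). $g(n,m)$ is the maximum size $k$ of a uniquely resolvable multiset with respect to $(n,m)$. -}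

module Defs where

open import Data.Nat using (ℕ; suc; _+_; _*_; _∸_; _^_; _≤_; _<_)
open import Data.Fin using (Fin)
open import Data.Fin.Subset using (Subset; _∈_; Nonempty)
open import Data.Product using (Σ; ∃; _×_; _,_)
open import Relation.Binary.PropositionalEquality using (_≡_)
open import Function.Bundles using (_⇔_)

-- A multiset of k non-empty subsets of [m], indexed by Fin k.
-- (Non-emptiness of the members is recorded separately.)
Family : ℕ → ℕ → Set
Family k m = Fin k → Subset m

AllNonempty : ∀ {k m} → Family k m → Set
AllNonempty {k} F = (j : Fin k) → Nonempty (F j)

-- A resolution into n classes, represented by the class-assignment map
-- c : [k] → [n]; block A_i = c⁻¹(i).
IsResolution : ∀ {k m} (n : ℕ) → Family k m → (Fin k → Fin n) → Set
IsResolution {k} {m} n F c =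
  ((i : Fin n) → ∃ λ (j : Fin k) → c j ≡ i)
  × ((i : Fin n) (x : Fin m) → ∃ λ (j : Fin k) → c j ≡ i × x ∈ F j)
  × ((j j′ : Fin k) (x : Fin m) → c j ≡ c j′ → x ∈ F j → x ∈ F j′ → j ≡ j′)

SamePartition : ∀ {k n} → (Fin k → Fin n) → (Fin k → Fin n) → Set
SamePartition {k} c c′ = (j j′ : Fin k) → (c j ≡ c j′) ⇔ (c′ j ≡ c′ j′)

UniquelyResolvable : ∀ {k m} (n : ℕ) → Family k m → Set
UniquelyResolvable {k} n F =
  AllNonempty F ×
  (Σ (Fin k → Fin n) λ c → IsResolution n F c
     × ((c′ : Fin k → Fin n) → IsResolution n F c′ → SamePartition c c′))

-- Integer form of  k > n(m+1) / (log₂(n+1) + 2)  (for k, n ≥ 1):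
-- equivalent to  2^(n(m+1) - 2k) < (n+1)^k  (truncated subtraction).
BeatsBound : ℕ → ℕ → ℕ → Set
BeatsBound n m k = 2 ^ (n * (m + 1) ∸ 2 * k) < (suc n) ^ k

-- For 2^e ≤ n < 2^(e+1), give the n classes distinct nonzero binary codewords of length e+1,
-- and cut [m] into R+1 blocks of e+2 points plus fewer than e+2 leftover points.  Class i
-- splits [m] into its R+2 level sets: in block q the first point has level q+1 for every class,
-- the point of digit d has level q or q+1 according as digit d of the codeword of i is 1 or 0,
-- and the leftover points have level R+1.  These n(R+2) sets satisfy n(m+1) ≤ n(R+2)(e+2),
-- which is the bound.  In any resolution, the first points of the blocks force every class to
-- contain exactly one set of each level ≥ 1; points where a codeword has a 1 in block 0 then
-- give every class a set of level 0, hence by counting exactly one.  A point where the codewords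
-- of i ≠ j differ in block a would be covered twice or not at all by a class containing the
-- level-a set of i and the level-(a+1) set of j, so every class stays with one i at all levels.
module Submission where

open import Defs
open import Data.Nat
  using (ℕ; zero; suc; _+_; _*_; _∸_; _^_; _≤_; _<_; s≤s; NonZero; pred; _≤?_; >-nonZero)
open import Data.Product using (Σ; _×_; ∃; ∃₂; _,_; proj₁; proj₂; uncurry)

open import Data.Fin
  using (Fin; zero; suc; toℕ; inject₁; inject≤; fromℕ; _↑ʳ_; splitAt; combine; remQuot; quotient
        ; finToFun; funToFin; punchIn; punchOut)
  renaming (_≟_ to _≟ᶠ_)
open import Data.Fin.Properties
  using ( 0≢1+n; suc-injective; toℕ-↑ˡ; toℕ-inject≤; inject≤-injective; splitAt-↑ʳ
        ; remQuot-combine; combine-injectiveˡ; combine-surjective; funToFin-finToFin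
        ; ¬∀⟶∃¬; punchIn-punchOut; injective⇒≤; <⇒≢; ≤̄⇒inject₁<)
  renaming (≤-refl to ≤ᶠ-refl)
open import Data.Fin.Induction using (<-weakInduction)
open import Data.Fin.Subset using (Subset; _∈_)
open import Data.Nat.DivMod using (_/_; _%_; m≡m%n+[m/n]*n; m%n<n; m≥n⇒m/n>0)
open import Data.Nat.Properties
  using ( ≤-refl; m<n⇒m<1+n; ≰⇒>; <⇒≱; 1+n≰n; 1+n≢0; +-comm; +-monoˡ-≤; *-monoʳ-≤
        ; *-assoc; *-comm; *-distribʳ-+; suc-pred; m*n≢0; m≤n+o⇒m∸n≤o
        ; ^-monoʳ-≤; ^-monoˡ-<; ^-*-assoc; module ≤-Reasoning)
open import Data.Sum using (_⊎_; inj₁; inj₂; [_,_]′; map)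
open import Data.Vec using (tabulate)
open import Data.Vec.Properties using (lookup∘tabulate; []=⇒lookup; lookup⇒[]=)
open import Data.Bool.Properties using (T-≡)
open import Function using (_∘_)
open import Function.Bundles using (_⇔_; mk⇔; Equivalence)
open import Function.Definitions using (Injective; StrictlySurjective)
import Function.Properties.Equivalence as ⇔
open import Level using (0ℓ)
open import Relation.Nullary using (yes; no; contradiction)
open import Relation.Nullary.Decidable using (⌊_⌋; toWitness; fromWitness)
open import Relation.Unary using (Pred; Decidable)
open import Relation.Binary.PropositionalEquality
  using (_≡_; _≢_; _≗_; refl; sym; trans; cong; cong₂; subst; module ≡-Reasoning)

open Equivalence using (to; from)

toSubset : ∀ {m} {P : Pred (Fin m) 0ℓ} → Decidable P → Subset m
toSubset P? = tabulate (λ x → ⌊ P? x ⌋)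

∈-toSubset : ∀ {m} {P : Pred (Fin m) 0ℓ} (P? : Decidable P) {x} → x ∈ toSubset P? ⇔ P x
∈-toSubset P? {x} = mk⇔
  (λ x∈ → toWitness {a? = P? x} (from T-≡ (trans (sym (lookup∘tabulate _ x)) ([]=⇒lookup x∈))))
  (λ Px → lookup⇒[]= x _ (trans (lookup∘tabulate _ x) (to T-≡ (fromWitness Px))))

-- If f a ≡ f b with a ≢ b, then f is still surjective off b, and choosing preimages off b
-- injects Fin (1 + n) into Fin n.
strictlySurjective⇒injective : ∀ {n} (f : Fin n → Fin n) →
  StrictlySurjective _≡_ f → Injective _≡_ _≡_ f
strictlySurjective⇒injective {suc n} f surj {a} {b} fa≡fb with a ≟ᶠ b
... | yes a≡b = a≡b
... | no a≢b = contradiction (injective⇒≤ section-injective) 1+n≰n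
  where
  surj-off-b : ∀ y → ∃ λ x → f (punchIn b x) ≡ y
  surj-off-b y with surj y
  ... | x , fx≡y with b ≟ᶠ x
  ...   | yes refl =
    punchOut (a≢b ∘ sym) , trans (cong f (punchIn-punchOut (a≢b ∘ sym))) (trans fa≡fb fx≡y)
  ...   | no b≢x   = punchOut b≢x , trans (cong f (punchIn-punchOut b≢x)) fx≡y

  section-injective : Injective _≡_ _≡_ (proj₁ ∘ surj-off-b)
  section-injective {y} {y′} e =
    trans (sym (proj₂ (surj-off-b y))) (trans (cong (f ∘ punchIn b) e) (proj₂ (surj-off-b y′)))

Band : ∀ {R} → Fin (suc R) → Fin (2 + R) → Set
Band a b = b ≡ inject₁ a ⊎ b ≡ suc a

record Layering (n m R : ℕ) : Set where
  field
    level         : Fin n → Fin m → Fin (2 + R)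
    uniform       : Fin (suc R) → Fin m
    level-uniform : ∀ a i → level i (uniform a) ≡ suc a
    separator     : ∀ a {i j} → i ≢ j →
                    ∃ λ y → level i y ≢ level j y × ∀ l → Band a (level l y)
    base          : ∀ i → ∃ λ y → level i y ≡ zero × ∀ l → Band zero (level l y)

module _ {n m R} (L : Layering n m R) where
  open Layering L

  piece : Fin n → Fin (2 + R) → Subset m
  piece i a = toSubset (λ x → level i x ≟ᶠ a)

  layered : Family (n * (2 + R)) m
  layered j = uncurry piece (remQuot {n} (2 + R) j)

  ∈-layered : ∀ {i a x} → x ∈ layered (combine i a) ⇔ level i x ≡ a
  ∈-layered {i} {a} {x} =
    subst (λ S → x ∈ S ⇔ level i x ≡ a) (cong (uncurry piece) (sym (remQuot-combine {n} {2 + R} i a)))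
      (∈-toSubset (λ x → level i x ≟ᶠ a))

  class : Fin (n * (2 + R)) → Fin n
  class = quotient {n} (2 + R)

  class-combine : ∀ i a → class (combine i a) ≡ i
  class-combine i a = cong proj₁ (remQuot-combine {n} {2 + R} i a)

  class-≡ : ∀ {i a i′ a′} → class (combine i a) ≡ class (combine i′ a′) ⇔ i ≡ i′
  class-≡ {i} {a} {i′} {a′} = mk⇔
    (λ e → trans (sym (class-combine i a)) (trans e (class-combine i′ a′)))
    (λ { refl → trans (class-combine i a) (sym (class-combine i a′)) })

  layered-nonempty : AllNonempty layered
  layered-nonempty j with combine-surjective {n} {2 + R} j
  ... | i , zero  , refl = let (y , level≡0 , _) = base i in y , from ∈-layered level≡0
  ... | i , suc a , refl = uniform a , from ∈-layered (level-uniform a i)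

  class-resolution : IsResolution n layered class
  class-resolution = surjective , covers , disjoint
    where
    surjective : ∀ i → ∃ λ j → class j ≡ i
    surjective i = combine i zero , class-combine i zero

    covers : ∀ i x → ∃ λ j → class j ≡ i × x ∈ layered j
    covers i x = combine i (level i x) , class-combine i (level i x) , from ∈-layered refl

    disjoint : ∀ j j′ x → class j ≡ class j′ → x ∈ layered j → x ∈ layered j′ → j ≡ j′
    disjoint j j′ x e x∈j x∈j′ with combine-surjective {n} {2 + R} j | combine-surjective {n} {2 + R} j′
    ... | i , a , refl | i′ , a′ , refl
      with refl ← to class-≡ e
      = cong (combine i) (trans (sym (to ∈-layered x∈j)) (to ∈-layered x∈j′))

  module _ (c : Fin (n * (2 + R)) → Fin n) (res : IsResolution n layered c) where

    κ : Fin n → Fin (2 + R) → Fin n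
    κ i a = c (combine i a)

    κ-covers : ∀ K x → ∃ λ l → κ l (level l x) ≡ K
    κ-covers K x with proj₁ (proj₂ res) K x
    ... | j , cj≡K , x∈j with combine-surjective {n} {2 + R} j
    ...   | l , a , refl with refl ← to ∈-layered x∈j = l , cj≡K

    κ-covers-uniform : ∀ K a → ∃ λ j → κ j (suc a) ≡ K
    κ-covers-uniform K a with κ-covers K (uniform a)
    ... | j , e = j , subst (λ b → κ j b ≡ K) (level-uniform a j) e

    κ-disjoint : ∀ {i j a b x} → level i x ≡ a → level j x ≡ b → κ i a ≡ κ j b → i ≡ j
    κ-disjoint {i} {j} {x = x} refl refl e =
      combine-injectiveˡ i _ j _ (proj₂ (proj₂ res) _ _ x e (from ∈-layered refl) (from ∈-layered refl))

    κ-suc-injective : ∀ a {i j} → κ i (suc a) ≡ κ j (suc a) → i ≡ j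
    κ-suc-injective a = κ-disjoint (level-uniform a _) (level-uniform a _)

    κ-zero-surjective : StrictlySurjective _≡_ (λ l → κ l zero)
    κ-zero-surjective K with κ-covers-uniform K zero
    ... | j , κj1≡K with base j
    ... | y , jy≡0 , band with κ-covers K y
    ... | l , κl≡K with band l
    ... | inj₁ ly≡0 = l , subst (λ b → κ l b ≡ K) ly≡0 κl≡K
    ... | inj₂ ly≡1
      with refl ← κ-suc-injective zero (trans (subst (λ b → κ l b ≡ K) ly≡1 κl≡K) (sym κj1≡K))
      = contradiction (trans (sym jy≡0) ly≡1) 0≢1+n

    κ-injective : ∀ a {i j} → κ i a ≡ κ j a → i ≡ j
    κ-injective zero    = strictlySurjective⇒injective (λ l → κ l zero) κ-zero-surjective
    κ-injective (suc a) = κ-suc-injective a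

    κ-injective-at : ∀ {l i y b} → κ l (level l y) ≡ κ i b → level l y ≡ b → level i y ≡ b
    κ-injective-at {l} {y = y} e refl with refl ← κ-injective (level l y) e = refl

    band-covered : ∀ {a i j y} → κ j (suc a) ≡ κ i (inject₁ a) → (∀ l → Band a (level l y)) →
                   level i y ≡ inject₁ a ⊎ level j y ≡ suc a
    band-covered {a} {i} {j} {y} κj≡κi band with κ-covers (κ i (inject₁ a)) y
    ... | l , κl≡κi =
      map (κ-injective-at κl≡κi) (κ-injective-at (trans κl≡κi (sym κj≡κi))) (band l)

    -- The class of the level-a set of i and the level-(a+1) set of j would cover the separator
    -- of i and j twice or not at all.
    band-no-switch : ∀ a {i j} → i ≢ j → κ j (suc a) ≢ κ i (inject₁ a)
    band-no-switch a {i} {j} i≢j κj≡κi with y , differ , band ← separator a i≢j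
      with band-covered κj≡κi band | band i | band j
    ... | inj₁ iy | _       | inj₁ jy = differ (trans iy (sym jy))
    ... | inj₁ iy | _       | inj₂ jy = i≢j (κ-disjoint iy jy (sym κj≡κi))
    ... | inj₂ jy | inj₁ iy | _       = i≢j (κ-disjoint iy jy (sym κj≡κi))
    ... | inj₂ jy | inj₂ iy | _       = differ (trans iy (sym jy))

    κ-step : ∀ a i → κ i (inject₁ a) ≡ κ i (suc a)
    κ-step a i with κ-covers-uniform (κ i (inject₁ a)) a
    ... | j , κj≡κi with i ≟ᶠ j
    ...   | yes refl = sym κj≡κi
    ...   | no i≢j   = contradiction κj≡κi (band-no-switch a i≢j)

    κ-constant : ∀ i a → κ i a ≡ κ i zero
    κ-constant i = <-weakInduction (λ a → κ i a ≡ κ i zero) refl (λ a ih → trans (sym (κ-step a i)) ih)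

    κ-≡ : ∀ {i a i′ a′} → κ i a ≡ κ i′ a′ ⇔ i ≡ i′
    κ-≡ {i} {a} {i′} {a′} = mk⇔
      (λ e → κ-injective zero (trans (sym (κ-constant i a)) (trans e (κ-constant i′ a′))))
      (λ { refl → trans (κ-constant i a) (sym (κ-constant i a′)) })

    class-samePartition : SamePartition class c
    class-samePartition j j′ with combine-surjective {n} {2 + R} j | combine-surjective {n} {2 + R} j′
    ... | i , a , refl | i′ , a′ , refl = ⇔.trans class-≡ (⇔.sym κ-≡)

  layered-uniquelyResolvable : UniquelyResolvable n layered
  layered-uniquelyResolvable = layered-nonempty , class , class-resolution , class-samePartition

record NonzeroCode (n c : ℕ) : Set where
  field
    word           : Fin n → Fin c → Fin 2
    word-separates : ∀ {i j} → i ≢ j → ∃ λ d → word i d ≢ word j d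
    word-nonzero   : ∀ i → ∃ λ d → word i d ≢ zero

funToFin-cong : ∀ {m n} {f g : Fin m → Fin n} → f ≗ g → funToFin f ≡ funToFin g
funToFin-cong {zero}  f≗g = refl
funToFin-cong {suc m} f≗g = cong₂ combine (f≗g zero) (funToFin-cong (f≗g ∘ suc))

finToFun-injective : ∀ {m n} {v w : Fin (m ^ n)} → finToFun {m} {n} v ≗ finToFun w → v ≡ w
finToFun-injective {m} {n} {v} {w} e = begin
  v                                     ≡⟨ funToFin-finToFin {n} {m} v ⟨
  funToFin {n} {m} (finToFun {m} {n} v) ≡⟨ funToFin-cong e ⟩
  funToFin {n} {m} (finToFun {m} {n} w) ≡⟨ funToFin-finToFin {n} {m} w ⟩
  w                                     ∎
  where open ≡-Reasoning

finToFun-separates : ∀ {m n} {v w : Fin (m ^ n)} → v ≢ w →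
                     ∃ λ d → finToFun {m} {n} v d ≢ finToFun w d
finToFun-separates {m} {n} {v} {w} v≢w =
  ¬∀⟶∃¬ n _ (λ d → finToFun v d ≟ᶠ finToFun w d) (v≢w ∘ finToFun-injective {m} {n})

toℕ-funToFin-zero : ∀ {m b} → toℕ (funToFin {m} {suc b} (λ _ → zero)) ≡ 0
toℕ-funToFin-zero {zero}  = refl
toℕ-funToFin-zero {suc m} = trans (toℕ-↑ˡ _ _) (toℕ-funToFin-zero {m})

finToFun-nonzero : ∀ {b n} {v : Fin (suc b ^ n)} → toℕ v ≢ 0 →
                   ∃ λ d → finToFun {suc b} {n} v d ≢ zero
finToFun-nonzero {b} {n} {v} v≢0 =
  ¬∀⟶∃¬ n _ (λ d → finToFun v d ≟ᶠ zero) λ all-zero → v≢0 (begin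
  toℕ v                                   ≡⟨ cong toℕ (funToFin-finToFin {n} {suc b} v) ⟨
  toℕ (funToFin {n} (finToFun {suc b} v)) ≡⟨ cong toℕ (funToFin-cong all-zero) ⟩
  toℕ (funToFin {n} {suc b} (λ _ → zero)) ≡⟨ toℕ-funToFin-zero {n} ⟩
  0                                       ∎)
  where open ≡-Reasoning

binaryCode : ∀ {n c} → n < 2 ^ c → NonzeroCode n c
binaryCode {n} {c} n<2^c = record
  { word           = finToFun {2} {c} ∘ codeword
  ; word-separates = λ i≢j →
      finToFun-separates {2} {c} (i≢j ∘ suc-injective ∘ inject≤-injective _ _ _ _)
  ; word-nonzero   = λ i → finToFun-nonzero {1} {c} (1+n≢0 ∘ trans (sym (toℕ-inject≤ (suc i) n<2^c)))
  }
  where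
  codeword : Fin n → Fin (2 ^ c)
  codeword i = inject≤ (suc i) n<2^c

module _ {n c} (code : NonzeroCode n c) (R t : ℕ) where
  open NonzeroCode code

  digitLevel : Fin 2 → Fin (suc R) → Fin (2 + R)
  digitLevel zero    q = suc q
  digitLevel (suc _) q = inject₁ q

  cellLevel : Fin n → Fin (suc R) → Fin (suc c) → Fin (2 + R)
  cellLevel i q zero    = suc q
  cellLevel i q (suc d) = digitLevel (word i d) q

  staircaseLevel : Fin n → Fin (t + suc R * suc c) → Fin (2 + R)
  staircaseLevel i x =
    [ (λ _ → fromℕ (suc R)) , uncurry (cellLevel i) ∘ remQuot (suc c) ]′ (splitAt t x)

  cell : Fin (suc R) → Fin (suc c) → Fin (t + suc R * suc c)
  cell q p = t ↑ʳ combine q p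

  level-cell : ∀ i q p → staircaseLevel i (cell q p) ≡ cellLevel i q p
  level-cell i q p rewrite splitAt-↑ʳ t (suc R * suc c) (combine q p) =
    cong (uncurry (cellLevel i)) (remQuot-combine q p)

  digitLevel-band : ∀ b q → Band q (digitLevel b q)
  digitLevel-band zero    q = inj₂ refl
  digitLevel-band (suc _) q = inj₁ refl

  digitLevel-injective : ∀ {b b′ q} → digitLevel b q ≡ digitLevel b′ q → b ≡ b′
  digitLevel-injective {zero}     {zero}     e = refl
  digitLevel-injective {suc zero} {suc zero} e = refl
  digitLevel-injective {zero}     {suc zero} e = contradiction (sym e) (<⇒≢ (≤̄⇒inject₁< ≤ᶠ-refl))
  digitLevel-injective {suc zero} {zero}     e = contradiction e (<⇒≢ (≤̄⇒inject₁< ≤ᶠ-refl))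

  digitLevel-nonzero : ∀ {b q} → b ≢ zero → digitLevel b q ≡ inject₁ q
  digitLevel-nonzero {zero}  b≢0 = contradiction refl b≢0
  digitLevel-nonzero {suc _} b≢0 = refl

  staircase : Layering n (t + suc R * suc c) R
  staircase = record
    { level         = staircaseLevel
    ; uniform       = λ a → cell a zero
    ; level-uniform = λ a i → level-cell i a zero
    ; separator     = separator
    ; base          = base
    }
    where
    separator : ∀ a {i j} → i ≢ j → ∃ λ y →
      staircaseLevel i y ≢ staircaseLevel j y × ∀ l → Band a (staircaseLevel l y)
    separator a {i} {j} i≢j with d , words-differ ← word-separates i≢j =
      cell a (suc d) , levels-differ , bands
      where
      levels-differ : staircaseLevel i (cell a (suc d)) ≢ staircaseLevel j (cell a (suc d))
      levels-differ rewrite level-cell i a (suc d) | level-cell j a (suc d) =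
        words-differ ∘ digitLevel-injective
      bands : ∀ l → Band a (staircaseLevel l (cell a (suc d)))
      bands l rewrite level-cell l a (suc d) = digitLevel-band (word l d) a

    base : ∀ i → ∃ λ y → staircaseLevel i y ≡ zero × ∀ l → Band zero (staircaseLevel l y)
    base i with d , word≢0 ← word-nonzero i =
      cell zero (suc d) , trans (level-cell i zero (suc d)) (digitLevel-nonzero word≢0) , bands
      where
      bands : ∀ l → Band zero (staircaseLevel l (cell zero (suc d)))
      bands l rewrite level-cell l zero (suc d) = digitLevel-band (word l d) zero

BeatingFamily : ℕ → ℕ → Set
BeatingFamily n m = Σ ℕ λ k → Σ (Family k m) λ F → UniquelyResolvable n F × BeatsBound n m k

size⇒beatsBound : ∀ {n m k e} .{{_ : NonZero k}} → 2 ^ e ≤ n → n * (m + 1) ≤ k * (2 + e) →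
                  BeatsBound n m k
size⇒beatsBound {n} {m} {k} {e} 2^e≤n size = begin-strict
  2 ^ (n * (m + 1) ∸ 2 * k) ≤⟨ ^-monoʳ-≤ 2 (m≤n+o⇒m∸n≤o (n * (m + 1)) (2 * k) size′) ⟩
  2 ^ (e * k)               ≡⟨ ^-*-assoc 2 e k ⟨
  (2 ^ e) ^ k               <⟨ ^-monoˡ-< k (s≤s 2^e≤n) ⟩
  suc n ^ k                 ∎
  where
  open ≤-Reasoning
  size′ : n * (m + 1) ≤ 2 * k + e * k
  size′ = subst (n * (m + 1) ≤_) (trans (*-comm k (2 + e)) (*-distribʳ-+ k 2 e)) size

blocks-size : ∀ n R {t s} → t < s → n * (t + suc R * s + 1) ≤ n * (2 + R) * s
blocks-size n R {t} {s} t<s = begin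
  n * (t + suc R * s + 1) ≡⟨ cong (n *_) (+-comm (t + suc R * s) 1) ⟩
  n * (suc t + suc R * s) ≤⟨ *-monoʳ-≤ n (+-monoˡ-≤ (suc R * s) t<s) ⟩
  n * ((2 + R) * s)       ≡⟨ *-assoc n (2 + R) s ⟨
  n * (2 + R) * s         ∎
  where open ≤-Reasoning

staircase-beatingFamily : ∀ {n e} .{{_ : NonZero n}} R t → 2 ^ e ≤ n → n < 2 ^ suc e → t < 2 + e →
                          BeatingFamily n (t + suc R * (2 + e))
staircase-beatingFamily {n} R t 2^e≤n n<2^e+1 t<s =
  n * (2 + R) , layered L , layered-uniquelyResolvable L ,
  size⇒beatsBound {{m*n≢0 n (2 + R)}} 2^e≤n (blocks-size n R t<s)
  where L = staircase (binaryCode n<2^e+1) R t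

binary-magnitude : ∀ {n} N → 1 ≤ n → n < 2 ^ N → ∃ λ e → e < N × 2 ^ e ≤ n × n < 2 ^ suc e
binary-magnitude zero    1≤n n<1 = contradiction 1≤n (<⇒≱ n<1)
binary-magnitude {n} (suc N) 1≤n n<2^N+1 with 2 ^ N ≤? n
... | yes 2^N≤n = N , ≤-refl , 2^N≤n , n<2^N+1
... | no  2^N≰n with e , e<N , bounds ← binary-magnitude N 1≤n (≰⇒> 2^N≰n) =
  e , m<n⇒m<1+n e<N , bounds

positive-divMod : ∀ m s .{{_ : NonZero s}} → s ≤ m → ∃₂ λ t R → t < s × m ≡ t + suc R * s
positive-divMod m s s≤m = m % s , pred (m / s) , m%n<n m s , trans (m≡m%n+[m/n]*n m s)
  (cong (λ q → m % s + q * s) (sym (suc-pred (m / s) {{>-nonZero (m≥n⇒m/n>0 s≤m)}})))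

theorem23 : (n m : ℕ) → 1 ≤ n → 1 ≤ m → n + 1 ≤ 2 ^ (m ∸ 1) →
    Σ ℕ λ k → Σ (Family k m) λ F → UniquelyResolvable n F × BeatsBound n m k
theorem23 n (suc m) 1≤n _ n+1≤2^m
  with e , e<m , 2^e≤n , n<2^e+1 ← binary-magnitude m 1≤n (subst (_≤ 2 ^ m) (+-comm n 1) n+1≤2^m)
  with t , R , t<s , m≡ ← positive-divMod (suc m) (2 + e) (s≤s e<m)
  = subst (BeatingFamily n) (sym m≡) (staircase-beatingFamily {{>-nonZero 1≤n}} R t 2^e≤n n<2^e+1 t<s)
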